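{- Let $m\ge1$ and let $G$ be a graph maximizing $h(G)$ among all graphs with exactly $m$ edges. Then $G$ is a threshold graph, i.e. the vertex set of $G$ can be partitioned into a clique $K$ and a stable set $S$ such that the neighborhoods of the vertices of $S$ are nested (totally ordered by inclusion).
   Context: $h(G)=\sum_i f(d_i)$ where $(d_i)$ is the degree sequence of $G$ and $f(x)=x\log x$ (with $f(0)=0$). -}

module Defs where

open import Data.Nat using (ℕ; _*_; _^_; _<?_)
open import Data.Bool using (Bool; true; false; not; if_then_else_)
open import Data.Fin using (Fin; toℕ)
open import Data.List using (List; map; allFin)
open import Data.Nat.ListAction using (sum; product)
open import Relation.Nullary using (does)
open import Relation.Binary.PropositionalEquality using (_≡_; _≢_)
open import Data.Sum using (_⊎_)
open import Data.Product using (∃)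

record Graph : Set where
  field
    n      : ℕ
    adj    : Fin n → Fin n → Bool
    symm   : ∀ i j → adj i j ≡ adj j i
    irrefl : ∀ i → adj i i ≡ false
open Graph public

indicator : Bool → ℕ
indicator true  = 1
indicator false = 0

degree : (G : Graph) → Fin (n G) → ℕ
degree G i = sum (map (λ j → indicator (adj G i j)) (allFin (n G)))

edges : Graph → ℕ
edges G = sum (map (λ i → sum (map (λ j →
            indicator (does (toℕ i <? toℕ j)) * indicator (adj G i j))
          (allFin (n G)))) (allFin (n G)))

-- expH G = ∏_i d_i ^ d_i = exp (h G), where h G = Σ_i d_i log d_i
-- (Agda's 0 ^ 0 = 1 matches the convention f 0 = 0).
-- Since exp is strictly monotone, comparing h is the same as comparing expH.
expH : Graph → ℕ
expH G = product (map (λ i → degree G i ^ degree G i) (allFin (n G)))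

IsThreshold : Graph → Set
IsThreshold G = ∃ λ (inK : Fin (n G) → Bool) →
    (∀ u v → inK u ≡ true → inK v ≡ true → u ≢ v → adj G u v ≡ true)
  × ((∀ u v → inK u ≡ false → inK v ≡ false → adj G u v ≡ false)
  × (∀ u v → inK u ≡ false → inK v ≡ false →
       (∀ w → adj G u w ≡ true → adj G v w ≡ true)
     ⊎ (∀ w → adj G v w ≡ true → adj G u w ≡ true)))
  where open import Data.Product using (_×_)

-- Since x ↦ x ^ x is strictly log-convex on ℕ, moving one unit from a degree d(b) to a degree
-- d(a) ≥ d(b) strictly increases ∏ᵢ d(i) ^ d(i) = exp h(G).  Replacing an edge bw by a non-edge aw
-- does exactly that and, by the handshake lemma, keeps the number of edges.  Hence in a maximiser
-- every neighbour w ≠ a of b is a neighbour of a whenever d(b) ≤ d(a).  Put v in the clique unless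
-- some other vertex of degree at least d(v) misses v; this domination property makes the remaining
-- vertices pairwise non-adjacent with nested neighbourhoods.
{-# OPTIONS --safe #-}
module Submission where

open import Defs
open import Data.Nat using (ℕ; _≤_; _≥_)
open import Relation.Binary.PropositionalEquality using (_≡_)

open import Algebra.Bundles using (CommutativeMonoid)
open import Data.Bool using (Bool; true; false; if_then_else_)
import Data.Bool as Bool
open import Data.Bool.Properties using (¬-not)
open import Data.Empty using (⊥)
open import Data.Fin using (Fin; zero; suc; toℕ; punchIn) renaming (_≟_ to _≟ᶠ_)
open import Data.Fin.Properties using (punchInᵢ≢i; toℕ-injective; any?)
import Data.List as List
open import Data.List.Properties using (map-tabulate; map-cong)
open import Data.Nat
open import Data.Nat.Properties
import Data.Nat.ListAction as ListAction
open import Data.Nat.Tactic.RingSolver using (solve-∀)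
open import Data.Product using (∃; _×_; _,_; proj₁)
open import Data.Sum using (_⊎_; inj₁; inj₂; [_,_])
open import Data.Vec.Functional as Vector using (Vector; removeAt; updateAt)
open import Data.Vec.Functional.Properties using (updateAt-updates; updateAt-minimal)
open import Function using (id; _∘_)
open import Relation.Binary.Definitions using (tri<; tri≈; tri>)
open import Relation.Binary.PropositionalEquality
  using (_≢_; refl; sym; trans; cong; cong₂; subst; subst₂; ≢-sym; module ≡-Reasoning)
open import Relation.Nullary using (¬_; Dec; yes; no; does; ¬?; _×-dec_; _⊎-dec_; contradiction)
open import Relation.Nullary.Decidable using (dec-true; dec-false)

^-distribʳ-* : ∀ x y k → (x * y) ^ k ≡ x ^ k * y ^ k
^-distribʳ-* x y zero    = refl
^-distribʳ-* x y (suc k) = trans (cong (x * y *_) (^-distribʳ-* x y k)) (interchange x y (x ^ k) (y ^ k))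
  where
  interchange : ∀ a b c d → a * b * (c * d) ≡ a * c * (b * d)
  interchange = solve-∀

-- Bernoulli's inequality (1 - 1/(y+1))^(k+1) ≥ 1 - (k+1)/(y+1), cleared of denominators.
bernoulli : ∀ y k → suc y ^ suc k ≤ y ^ suc k + suc k * suc y ^ k
bernoulli y zero    = ≤-reflexive (base y)
  where
  base : ∀ y → suc y * 1 ≡ y * 1 + 1 * 1
  base = solve-∀
bernoulli y (suc k) = begin
  suc y * suc y ^ suc k                                    ≤⟨ *-monoʳ-≤ (suc y) (bernoulli y k) ⟩
  suc y * (y ^ suc k + suc k * suc y ^ k)                  ≡⟨ expand y (y ^ suc k) (suc y ^ k) k ⟩
  y ^ suc (suc k) + y ^ suc k + suc k * suc y ^ suc k      ≤⟨ +-monoˡ-≤ _ (+-monoʳ-≤ (y ^ suc (suc k)) y^k≤) ⟩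
  y ^ suc (suc k) + suc y ^ suc k + suc k * suc y ^ suc k  ≡⟨ +-assoc (y ^ suc (suc k)) (suc y ^ suc k) _ ⟩
  y ^ suc (suc k) + suc (suc k) * suc y ^ suc k            ∎
  where
  open ≤-Reasoning
  y^k≤ : y ^ suc k ≤ suc y ^ suc k
  y^k≤ = ^-monoˡ-≤ (suc k) (n≤1+n y)
  expand : ∀ y a b k → suc y * (a + suc k * b) ≡ y * a + a + suc k * (suc y * b)
  expand = solve-∀

-- (1 + 1/x)^x ≤ (1 + 1/(x+1))^(x+1), cleared of denominators; note (x+1)² = x(x+2) + 1.
euler-mono : ∀ x → suc x * suc (x * (2 + x)) ^ x ≤ (2 + x) * (x * (2 + x)) ^ x
euler-mono zero       = s≤s z≤n
euler-mono x@(suc _) = *-cancelˡ-≤ x (+-cancelʳ-≤ (suc x * Y) _ _ (begin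
  x * (suc x * Y) + suc x * Y        ≡⟨ split x Y ⟩
  suc y ^ suc x                      ≤⟨ bernoulli y x ⟩
  y ^ suc x + suc x * Y              ≡⟨ cong (_+ suc x * Y) (*-assoc x (2 + x) (y ^ x)) ⟩
  x * ((2 + x) * y ^ x) + suc x * Y  ∎))
  where
  open ≤-Reasoning
  y Y : ℕ
  y = x * (2 + x)
  Y = suc y ^ x
  split : ∀ z Z → z * (suc z * Z) + suc z * Z ≡ suc (z * (2 + z)) * Z
  split = solve-∀

selfPow-logConvex : ∀ x → suc x ^ suc x * suc x ^ suc x < x ^ x * (2 + x) ^ (2 + x)
selfPow-logConvex zero       = s≤s (s≤s z≤n)
selfPow-logConvex x@(suc _) = begin-strict
  suc x ^ suc x * suc x ^ suc x       ≡⟨ ^-distribʳ-* (suc x) (suc x) (suc x) ⟨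
  (suc x * suc x) ^ suc x             ≡⟨ cong (_^ suc x) (square x) ⟩
  suc y ^ suc x                       ≡⟨ regroup x (suc y ^ x) ⟩
  suc x * (suc x * suc y ^ x)         ≤⟨ *-monoʳ-≤ (suc x) (euler-mono x) ⟩
  suc x * ((2 + x) * y ^ x)           <⟨ *-monoˡ-< ((2 + x) * y ^ x) {{>-nonZero positive}} (n<1+n (suc x)) ⟩
  (2 + x) * ((2 + x) * y ^ x)         ≡⟨ cong (λ z → (2 + x) * ((2 + x) * z)) (^-distribʳ-* x (2 + x) x) ⟩
  (2 + x) * ((2 + x) * (x ^ x * (2 + x) ^ x))  ≡⟨ collect (2 + x) (x ^ x) ((2 + x) ^ x) ⟩
  x ^ x * (2 + x) ^ (2 + x)           ∎
  where
  open ≤-Reasoning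
  y : ℕ
  y = x * (2 + x)
  positive : (2 + x) * y ^ x > 0
  positive = *-mono-≤ {1} {2 + x} {1} {y ^ x} (s≤s z≤n) (m^n>0 y x)
  square : ∀ z → suc z * suc z ≡ suc (z * (2 + z))
  square = solve-∀
  regroup : ∀ z Z → suc (z * (2 + z)) * Z ≡ suc z * (suc z * Z)
  regroup = solve-∀
  collect : ∀ s p q → s * (s * (p * q)) ≡ p * (s * (s * q))
  collect = solve-∀

-- The ratio (x + 1) ^ (x + 1) / x ^ x strictly increases with x: chain selfPow-logConvex from c to a.
selfPow-transfer-< : ∀ {c a} → c < a → a ^ a * suc c ^ suc c < suc a ^ suc a * c ^ c
selfPow-transfer-< c<a = go (<⇒<′ c<a)
  where
  go : ∀ {c a} → c <′ a → a ^ a * suc c ^ suc c < suc a ^ suc a * c ^ c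
  go {c} ≤′-refl = subst (suc c ^ suc c * suc c ^ suc c <_) (*-comm (c ^ c) _) (selfPow-logConvex c)
  go {c} {suc a} (≤′-step c<a) = *-cancelʳ-< (a ^ a * S) (S * C) (T * c ^ c) (begin-strict
    S * C * (a ^ a * S)          ≡⟨ shuffle S C (a ^ a) ⟩
    a ^ a * C * (S * S)          <⟨ *-mono-< (go c<a) (selfPow-logConvex a) ⟩
    S * c ^ c * (a ^ a * T)      ≡⟨ swap S (c ^ c) (a ^ a) T ⟩
    T * c ^ c * (a ^ a * S)      ∎)
    where
    open ≤-Reasoning
    C S T : ℕ
    C = suc c ^ suc c
    S = suc a ^ suc a
    T = suc (suc a) ^ suc (suc a)
    shuffle : ∀ s p q → s * p * (q * s) ≡ q * p * (s * s)
    shuffle = solve-∀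
    swap : ∀ s p q t → s * p * (q * t) ≡ t * p * (q * s)
    swap = solve-∀

selfPow>0 : ∀ x → x ^ x > 0
selfPow>0 zero    = z<s
selfPow>0 (suc x) = m^n>0 (suc x) (suc x)

foldr-map-allFin : ∀ {a b} {A : Set a} {B : Set b} (c : A → B → B) (e : B) {m} (f : Fin m → A) →
                   List.foldr c e (List.map f (List.allFin m)) ≡ Vector.foldr c e f
foldr-map-allFin {A = A} c e f = trans (cong (List.foldr c e) (map-tabulate id f)) (foldr-tabulate f)
  where
  foldr-tabulate : ∀ {m} (f : Fin m → A) → List.foldr c e (List.tabulate f) ≡ Vector.foldr c e f
  foldr-tabulate {zero}  f = refl
  foldr-tabulate {suc m} f = cong (c (f zero)) (foldr-tabulate (f ∘ suc))

module _ {c ℓ} (M : CommutativeMonoid c ℓ) where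
  open CommutativeMonoid M
    using (Carrier; _≈_; _∙_; ∙-cong; ∙-congʳ; reflexive; setoid; commutativeSemigroup)
    renaming (trans to ≈-trans)
  open import Algebra.Properties.CommutativeMonoid.Sum M using (sum; sum-remove; sum-cong-≋)
  open import Algebra.Properties.CommutativeSemigroup commutativeSemigroup
    using (xy∙z≈xz∙y; x∙yz≈y∙xz; x∙yz≈z∙yx)
  open import Relation.Binary.Reasoning.Setoid setoid

  sum-exchange : ∀ {m} (f g : Vector Carrier m) (k : Fin m) {x y : Carrier} →
                 (∀ j → j ≢ k → f j ≈ g j) → f k ∙ x ≈ g k ∙ y → sum f ∙ x ≈ sum g ∙ y
  sum-exchange {suc _} f g k {x} {y} f≈g fx≈gy = begin
    sum f ∙ x                     ≈⟨ ∙-congʳ (sum-remove {i = k} f) ⟩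
    f k ∙ sum (removeAt f k) ∙ x  ≈⟨ xy∙z≈xz∙y _ _ _ ⟩
    f k ∙ x ∙ sum (removeAt f k)  ≈⟨ ∙-cong fx≈gy (sum-cong-≋ λ j → f≈g (punchIn k j) (punchInᵢ≢i k j)) ⟩
    g k ∙ y ∙ sum (removeAt g k)  ≈⟨ xy∙z≈xz∙y _ _ _ ⟨
    g k ∙ sum (removeAt g k) ∙ y  ≈⟨ ∙-congʳ (sum-remove {i = k} g) ⟨
    sum g ∙ y                     ∎

  sum-exchange₂ : ∀ {m} (f g : Vector Carrier m) {k l : Fin m} → k ≢ l →
                  (∀ j → j ≢ k → j ≢ l → f j ≈ g j) → sum f ∙ (g k ∙ g l) ≈ sum g ∙ (f k ∙ f l)
  sum-exchange₂ f g {k} {l} k≢l f≈g = begin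
    sum f ∙ (g k ∙ g l)  ≈⟨ sum-exchange f h k f≈h fk≈hk ⟩
    sum h ∙ (f k ∙ g l)  ≈⟨ sum-exchange h g l h≈g hl≈gl ⟩
    sum g ∙ (f k ∙ f l)  ∎
    where
    h : Vector Carrier _
    h = updateAt f k (λ _ → g k)
    f≈h : ∀ j → j ≢ k → f j ≈ h j
    f≈h j j≢k = reflexive (sym (updateAt-minimal j k f j≢k))
    h≈g : ∀ j → j ≢ l → h j ≈ g j
    h≈g j j≢l with j ≟ᶠ k
    ... | yes refl = reflexive (updateAt-updates k f)
    ... | no j≢k   = ≈-trans (reflexive (updateAt-minimal j k f j≢k)) (f≈g j j≢k j≢l)
    fk≈hk : f k ∙ (g k ∙ g l) ≈ h k ∙ (f k ∙ g l)
    fk≈hk = ≈-trans (x∙yz≈y∙xz _ _ _) (∙-congʳ (reflexive (sym (updateAt-updates k f))))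
    hl≈gl : h l ∙ (f k ∙ g l) ≈ g l ∙ (f k ∙ f l)
    hl≈gl = ≈-trans (∙-congʳ (reflexive (updateAt-minimal l k f (≢-sym k≢l)))) (x∙yz≈z∙yx _ _ _)

open import Algebra.Properties.CommutativeMonoid.Sum +-0-commutativeMonoid
  using (sum-syntax; sum-cong-≗; ∑-comm; ∑-distrib-+) renaming (sum to ∑)
open import Algebra.Properties.CommutativeMonoid.Sum *-1-commutativeMonoid
  using () renaming (sum to ∏)

∏-pos : ∀ {m} (f : Fin m → ℕ) → (∀ i → f i > 0) → ∏ f > 0
∏-pos {zero}  f pos = z<s
∏-pos {suc m} f pos = *-mono-≤ (pos zero) (∏-pos (f ∘ suc) (pos ∘ suc))

degree-∑ : ∀ G i → degree G i ≡ ∑[ j < n G ] indicator (adj G i j)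
degree-∑ G i = foldr-map-allFin _+_ 0 (λ j → indicator (adj G i j))

expH-∏ : ∀ G → expH G ≡ ∏ (λ i → degree G i ^ degree G i)
expH-∏ G = foldr-map-allFin _*_ 1 (λ i → degree G i ^ degree G i)

indicator-<?-exactlyOne : ∀ {m} {i j : Fin m} → i ≢ j →
                          indicator (does (toℕ i <? toℕ j)) + indicator (does (toℕ j <? toℕ i)) ≡ 1
indicator-<?-exactlyOne {i = i} {j} i≢j with <-cmp (toℕ i) (toℕ j)
... | tri< i<j _ j≮i rewrite dec-true (toℕ i <? toℕ j) i<j | dec-false (toℕ j <? toℕ i) j≮i = refl
... | tri≈ _ i≡j _   = contradiction (toℕ-injective i≡j) i≢j
... | tri> i≮j _ j<i rewrite dec-false (toℕ i <? toℕ j) i≮j | dec-true (toℕ j <? toℕ i) j<i = refl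

handshake : ∀ G → 2 * edges G ≡ ∑[ i < n G ] degree G i
handshake G = begin
  2 * edges G                ≡⟨ cong (2 *_) edges-∑ ⟩
  2 * ∑ R                    ≡⟨ cong (∑ R +_) (+-identityʳ (∑ R)) ⟩
  ∑ R + ∑ R                  ≡⟨ cong (∑ R +_) transpose ⟩
  ∑ R + ∑ Rᵀ                 ≡⟨ ∑-distrib-+ R Rᵀ ⟨
  ∑[ i < n G ] (R i + Rᵀ i)  ≡⟨ sum-cong-≗ rows-split ⟩
  ∑[ i < n G ] degree G i    ∎
  where
  open ≡-Reasoning
  A L : Fin (n G) → Fin (n G) → ℕ
  A i j = indicator (adj G i j)
  L i j = indicator (does (toℕ i <? toℕ j))
  R Rᵀ : Fin (n G) → ℕ
  R  i = ∑[ j < n G ] (L i j * A i j)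
  Rᵀ i = ∑[ j < n G ] (L j i * A i j)
  edges-∑ : edges G ≡ ∑ R
  edges-∑ = trans (foldr-map-allFin _+_ 0 {n G} _)
                  (sum-cong-≗ λ i → foldr-map-allFin _+_ 0 (λ j → L i j * A i j))
  transpose : ∑ R ≡ ∑ Rᵀ
  transpose = trans (∑-comm (λ i j → L i j * A i j))
                    (sum-cong-≗ λ i → sum-cong-≗ λ j → cong (λ a → L j i * indicator a) (symm G j i))
  split : ∀ i j → L i j * A i j + L j i * A i j ≡ A i j
  split i j with i ≟ᶠ j
  ... | yes refl rewrite irrefl G i = cong₂ _+_ (*-zeroʳ (L i i)) (*-zeroʳ (L i i))
  ... | no i≢j  = begin
    L i j * A i j + L j i * A i j  ≡⟨ *-distribʳ-+ (A i j) (L i j) (L j i) ⟨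
    (L i j + L j i) * A i j        ≡⟨ cong (_* A i j) (indicator-<?-exactlyOne i≢j) ⟩
    1 * A i j                      ≡⟨ *-identityˡ (A i j) ⟩
    A i j                          ∎
  rows-split : ∀ i → R i + Rᵀ i ≡ degree G i
  rows-split i = begin
    R i + Rᵀ i                                    ≡⟨ ∑-distrib-+ (λ j → L i j * A i j) (λ j → L j i * A i j) ⟨
    ∑[ j < n G ] (L i j * A i j + L j i * A i j)  ≡⟨ sum-cong-≗ (split i) ⟩
    ∑[ j < n G ] A i j                            ≡⟨ degree-∑ G i ⟨
    degree G i                                    ∎

edges-≡ : ∀ {G H} → ∑[ i < n G ] degree G i ≡ ∑[ i < n H ] degree H i → edges G ≡ edges H
edges-≡ {G} {H} eq = *-cancelˡ-≡ (edges G) (edges H) 2 (trans (handshake G) (trans eq (sym (handshake H))))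

true≢false : true ≢ false
true≢false ()

nonNeighbour≢neighbour : ∀ G {u v w} → adj G u v ≡ false → adj G u w ≡ true → v ≢ w
nonNeighbour≢neighbour G u≁v u~w refl = true≢false (trans (sym u~w) u≁v)

SamePair : ∀ {m} → Fin m → Fin m → Fin m → Fin m → Set
SamePair p q i j = (i ≡ p × j ≡ q) ⊎ (i ≡ q × j ≡ p)

samePair? : ∀ {m} (p q i j : Fin m) → Dec (SamePair p q i j)
samePair? p q i j = (i ≟ᶠ p ×-dec j ≟ᶠ q) ⊎-dec (i ≟ᶠ q ×-dec j ≟ᶠ p)

module _ {m} {p q : Fin m} where

  samePair-swap : ∀ {i j} → SamePair p q i j → SamePair p q j i
  samePair-swap (inj₁ (i≡p , j≡q)) = inj₂ (j≡q , i≡p)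
  samePair-swap (inj₂ (i≡q , j≡p)) = inj₁ (j≡p , i≡q)

  samePair-irrefl : p ≢ q → ∀ {i} → ¬ SamePair p q i i
  samePair-irrefl p≢q (inj₁ (i≡p , i≡q)) = p≢q (trans (sym i≡p) i≡q)
  samePair-irrefl p≢q (inj₂ (i≡q , i≡p)) = p≢q (trans (sym i≡p) i≡q)

  samePair-functional : p ≢ q → ∀ {i j k} → SamePair p q i j → SamePair p q i k → j ≡ k
  samePair-functional _   (inj₁ (_ , refl))    (inj₁ (_ , refl))   = refl
  samePair-functional p≢q (inj₁ (refl , _))    (inj₂ (p≡q , _))   = contradiction p≡q p≢q
  samePair-functional p≢q (inj₂ (refl , _))    (inj₁ (q≡p , _))   = contradiction (sym q≡p) p≢q
  samePair-functional _   (inj₂ (_ , refl))    (inj₂ (_ , refl))   = refl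

adj-samePair : ∀ G {p q i j : Fin (n G)} → SamePair p q i j → adj G i j ≡ adj G p q
adj-samePair G (inj₁ (refl , refl)) = refl
adj-samePair G (inj₂ (refl , refl)) = symm G _ _

module _ (G : Graph) {p q : Fin (n G)} (p≢q : p ≢ q) (b : Bool) where

  setAdj : Fin (n G) → Fin (n G) → Bool
  setAdj i j = if does (samePair? p q i j) then b else adj G i j

  setAdj-samePair : ∀ {i j} → SamePair p q i j → setAdj i j ≡ b
  setAdj-samePair {i} {j} e = cong (if_then b else adj G i j) (dec-true (samePair? p q i j) e)

  setAdj-other : ∀ {i j} → ¬ SamePair p q i j → setAdj i j ≡ adj G i j
  setAdj-other {i} {j} ¬e = cong (if_then b else adj G i j) (dec-false (samePair? p q i j) ¬e)

  setAdj-symm : ∀ i j → setAdj i j ≡ setAdj j i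
  setAdj-symm i j with samePair? p q i j
  ... | yes e = trans (setAdj-samePair e) (sym (setAdj-samePair (samePair-swap e)))
  ... | no ¬e = trans (setAdj-other ¬e) (trans (symm G i j) (sym (setAdj-other (¬e ∘ samePair-swap))))

  setEdge : Graph
  setEdge = record
    { n      = n G
    ; adj    = setAdj
    ; symm   = setAdj-symm
    ; irrefl = λ i → trans (setAdj-other (samePair-irrefl p≢q)) (irrefl G i)
    }

  degree-setEdge-samePair : ∀ {i j} → SamePair p q i j →
                            degree setEdge i + indicator (adj G p q) ≡ degree G i + indicator b
  degree-setEdge-samePair {i} {j} e = begin
    degree setEdge i + indicator (adj G p q)
      ≡⟨ cong₂ _+_ (degree-∑ setEdge i) (cong indicator (sym (adj-samePair G e))) ⟩
    ∑ row′ + indicator (adj G i j)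
      ≡⟨ sum-exchange +-0-commutativeMonoid row′ row j rows-agree at-j ⟩
    ∑ row + indicator b
      ≡⟨ cong (_+ indicator b) (degree-∑ G i) ⟨
    degree G i + indicator b
      ∎
    where
    open ≡-Reasoning
    row′ row : Fin (n G) → ℕ
    row′ k = indicator (setAdj i k)
    row  k = indicator (adj G i k)
    rows-agree : ∀ k → k ≢ j → row′ k ≡ row k
    rows-agree k k≢j = cong indicator (setAdj-other (k≢j ∘ sym ∘ samePair-functional p≢q e))
    at-j : row′ j + row j ≡ row j + indicator b
    at-j = trans (cong (λ t → indicator t + row j) (setAdj-samePair e)) (+-comm (indicator b) (row j))

  degree-setEdge-other : ∀ {i} → i ≢ p → i ≢ q → degree setEdge i ≡ degree G i
  degree-setEdge-other {i} i≢p i≢q = cong ListAction.sum (map-cong row-unchanged (List.allFin (n G)))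
    where
    row-unchanged : ∀ j → indicator (setAdj i j) ≡ indicator (adj G i j)
    row-unchanged j = cong indicator (setAdj-other [ i≢p ∘ proj₁ , i≢q ∘ proj₁ ])

module _ (G : Graph) {p q : Fin (n G)} (p≢q : p ≢ q) where
  open ≡-Reasoning

  degree-removeEdge : adj G p q ≡ true → ∀ {i j} → SamePair p q i j →
                      suc (degree (setEdge G p≢q false) i) ≡ degree G i
  degree-removeEdge p~q {i} e = begin
    suc (degree G′ i)                     ≡⟨ +-comm 1 (degree G′ i) ⟩
    degree G′ i + 1                       ≡⟨ cong (λ t → degree G′ i + indicator t) p~q ⟨
    degree G′ i + indicator (adj G p q)   ≡⟨ degree-setEdge-samePair G p≢q false e ⟩
    degree G i + 0                        ≡⟨ +-identityʳ (degree G i) ⟩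
    degree G i                            ∎
    where
    G′ : Graph
    G′ = setEdge G p≢q false

  degree-addEdge : adj G p q ≡ false → ∀ {i j} → SamePair p q i j →
                   degree (setEdge G p≢q true) i ≡ suc (degree G i)
  degree-addEdge p≁q {i} e = begin
    degree G′ i                           ≡⟨ +-identityʳ (degree G′ i) ⟨
    degree G′ i + 0                       ≡⟨ cong (λ t → degree G′ i + indicator t) p≁q ⟨
    degree G′ i + indicator (adj G p q)   ≡⟨ degree-setEdge-samePair G p≢q true e ⟩
    degree G i + 1                        ≡⟨ +-comm (degree G i) 1 ⟩
    suc (degree G i)                      ∎
    where
    G′ : Graph
    G′ = setEdge G p≢q true

record UnitTransfer {m} (d d′ : Fin m → ℕ) (a b : Fin m) : Set where
  field
    gain      : d′ a ≡ suc (d a)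
    loss      : suc (d′ b) ≡ d b
    elsewhere : ∀ i → i ≢ a → i ≢ b → d′ i ≡ d i

  distinct : a ≢ b
  distinct refl = 1+n≰n (≤-trans (n≤1+n _) (≤-reflexive (trans (cong suc (sym gain)) loss)))

module _ {m} {d d′ : Fin m → ℕ} {a b : Fin m} (t : UnitTransfer d d′ a b) where
  open UnitTransfer t
  open ≤-Reasoning

  ∑-transfer : ∑ d′ ≡ ∑ d
  ∑-transfer = +-cancelʳ-≡ (d a + d b) (∑ d′) (∑ d) (begin-equality
    ∑ d′ + (d a + d b)        ≡⟨ sum-exchange₂ +-0-commutativeMonoid d′ d distinct elsewhere ⟩
    ∑ d + (d′ a + d′ b)       ≡⟨ cong (λ x → ∑ d + (x + d′ b)) gain ⟩
    ∑ d + suc (d a + d′ b)    ≡⟨ cong (∑ d +_) (+-suc (d a) (d′ b)) ⟨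
    ∑ d + (d a + suc (d′ b))  ≡⟨ cong (λ x → ∑ d + (d a + x)) loss ⟩
    ∑ d + (d a + d b)         ∎)

  ∏selfPow-transfer-< : d b ≤ d a → ∏ (λ i → d i ^ d i) < ∏ (λ i → d′ i ^ d′ i)
  ∏selfPow-transfer-< db≤da = *-cancelʳ-< (f a * f b) (∏ f) (∏ f′) (begin-strict
    ∏ f * (f a * f b)    <⟨ *-monoʳ-< (∏ f) {{>-nonZero (∏-pos f (selfPow>0 ∘ d))}} pair-< ⟩
    ∏ f * (f′ a * f′ b)  ≡⟨ sum-exchange₂ *-1-commutativeMonoid f′ f distinct same ⟨
    ∏ f′ * (f a * f b)   ∎)
    where
    f f′ : Fin m → ℕ
    f  i = d i ^ d i
    f′ i = d′ i ^ d′ i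
    same : ∀ i → i ≢ a → i ≢ b → f′ i ≡ f i
    same i i≢a i≢b = cong (λ x → x ^ x) (elsewhere i i≢a i≢b)
    pair-< : f a * f b < f′ a * f′ b
    pair-< = subst₂ _<_ (cong (λ x → d a ^ d a * x ^ x) loss) (cong (λ x → x ^ x * d′ b ^ d′ b) (sym gain))
                    (selfPow-transfer-< (subst (_≤ d a) (sym loss) db≤da))

module _ (G : Graph) {a b w : Fin (n G)} (b~w : adj G b w ≡ true) (a≁w : adj G a w ≡ false) (a≢w : a ≢ w) where
  private
    b≢w : b ≢ w
    b≢w = nonNeighbour≢neighbour G (irrefl G b) b~w
    a≢b : a ≢ b
    a≢b refl = true≢false (trans (sym b~w) a≁w)
    G₁ : Graph
    G₁ = setEdge G b≢w false
    a≁w-in-G₁ : adj G₁ a w ≡ false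
    a≁w-in-G₁ = trans (setAdj-other G b≢w false [ a≢b ∘ proj₁ , a≢w ∘ proj₁ ]) a≁w

  rotate : Graph
  rotate = setEdge G₁ a≢w true

  rotate-transfer : UnitTransfer (degree G) (degree rotate) a b
  rotate-transfer = record { gain = gain ; loss = loss ; elsewhere = elsewhere }
    where
    gain : degree rotate a ≡ suc (degree G a)
    gain = trans (degree-addEdge G₁ a≢w a≁w-in-G₁ (inj₁ (refl , refl)))
                 (cong suc (degree-setEdge-other G b≢w false a≢b a≢w))
    loss : suc (degree rotate b) ≡ degree G b
    loss = trans (cong suc (degree-setEdge-other G₁ a≢w true (≢-sym a≢b) b≢w))
                 (degree-removeEdge G b≢w b~w (inj₁ (refl , refl)))
    elsewhere : ∀ i → i ≢ a → i ≢ b → degree rotate i ≡ degree G i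
    elsewhere i i≢a i≢b = by-cases (i ≟ᶠ w)
      where
      by-cases : Dec (i ≡ w) → degree rotate i ≡ degree G i
      by-cases (yes refl) = trans (degree-addEdge G₁ a≢w a≁w-in-G₁ (inj₂ (refl , refl)))
                                  (degree-removeEdge G b≢w b~w (inj₂ (refl , refl)))
      by-cases (no i≢w)   = trans (degree-setEdge-other G₁ a≢w true i≢a i≢w)
                                  (degree-setEdge-other G b≢w false i≢b i≢w)

  edges-rotate : edges rotate ≡ edges G
  edges-rotate = edges-≡ {rotate} {G} (∑-transfer rotate-transfer)

  expH-rotate : degree G b ≤ degree G a → expH G < expH rotate
  expH-rotate db≤da =
    subst₂ _<_ (sym (expH-∏ G)) (sym (expH-∏ rotate)) (∏selfPow-transfer-< rotate-transfer db≤da)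

HMaximal : Graph → Set
HMaximal G = ∀ G′ → edges G′ ≡ edges G → expH G′ ≤ expH G

NestedByDegree : Graph → Set
NestedByDegree G = ∀ {a b w} → degree G b ≤ degree G a → adj G b w ≡ true → a ≢ w → adj G a w ≡ true

hMaximal⇒nestedByDegree : ∀ G → HMaximal G → NestedByDegree G
hMaximal⇒nestedByDegree G maximal {a} {b} {w} db≤da b~w a≢w with adj G a w in a≁w
... | true  = refl
... | false = contradiction (maximal (rotate G b~w a≁w a≢w) (edges-rotate G b~w a≁w a≢w))
                            (<⇒≱ (expH-rotate G b~w a≁w a≢w db≤da))

¬?-true⇒¬ : ∀ {a} {A : Set a} (a? : Dec A) → does (¬? a?) ≡ true → ¬ A
¬?-true⇒¬ (yes _) ()
¬?-true⇒¬ (no ¬a) _ = ¬a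

¬?-false⇒ : ∀ {a} {A : Set a} (a? : Dec A) → does (¬? a?) ≡ false → A
¬?-false⇒ (yes a) _ = a
¬?-false⇒ (no _) ()

module _ (G : Graph) where

  Blocks : Fin (n G) → Fin (n G) → Set
  Blocks v x = x ≢ v × degree G v ≤ degree G x × adj G x v ≡ false

  blocks? : ∀ v x → Dec (Blocks v x)
  blocks? v x = ¬? (x ≟ᶠ v) ×-dec degree G v ≤? degree G x ×-dec adj G x v Bool.≟ false

  inClique : Fin (n G) → Bool
  inClique v = does (¬? (any? (blocks? v)))

  unblocked : ∀ {v} → inClique v ≡ true → ¬ ∃ (Blocks v)
  unblocked {v} = ¬?-true⇒¬ (any? (blocks? v))

  blocker : ∀ {v} → inClique v ≡ false → ∃ (Blocks v)
  blocker {v} = ¬?-false⇒ (any? (blocks? v))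

  inClique-adjacent : ∀ u v → inClique u ≡ true → inClique v ≡ true → u ≢ v → adj G u v ≡ true
  inClique-adjacent u v u∈K v∈K u≢v with ≤-total (degree G v) (degree G u)
  ... | inj₁ dv≤du = ¬-not λ u≁v → unblocked v∈K (u , u≢v , dv≤du , u≁v)
  ... | inj₂ du≤dv = ¬-not λ u≁v → unblocked u∈K (v , ≢-sym u≢v , du≤dv , trans (symm G v u) u≁v)

module _ (G : Graph) (nested : NestedByDegree G) where

  blocked-nonadjacent : ∀ {u v} → adj G u v ≡ true → degree G v ≤ degree G u → ∃ (Blocks G v) → ∃ (Blocks G u) → ⊥
  blocked-nonadjacent {u} {v} u~v dv≤du (x , x≢v , dv≤dx , x≁v) (y , y≢u , du≤dy , y≁u)
    with degree G u ≤? degree G x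
  ... | yes du≤dx = true≢false (trans (sym (nested du≤dx u~v x≢v)) x≁v)
  ... | no du≰dx  = true≢false (trans (sym y~u) y≁u)
    where
    x≢u : x ≢ u
    x≢u refl = true≢false (trans (sym u~v) x≁v)
    x~u : adj G x u ≡ true
    x~u = nested dv≤dx (trans (symm G v u) u~v) x≢u
    y~u : adj G y u ≡ true
    y~u = nested (≤-trans (<⇒≤ (≰⇒> du≰dx)) du≤dy) x~u y≢u

  outside-nonadjacent : ∀ u v → inClique G u ≡ false → inClique G v ≡ false → adj G u v ≡ false
  outside-nonadjacent u v u∉K v∉K = ¬-not u≁v
    where
    u≁v : adj G u v ≢ true
    u≁v u~v with ≤-total (degree G v) (degree G u)
    ... | inj₁ dv≤du = blocked-nonadjacent u~v dv≤du (blocker G v∉K) (blocker G u∉K)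
    ... | inj₂ du≤dv = blocked-nonadjacent (trans (symm G v u) u~v) du≤dv (blocker G u∉K) (blocker G v∉K)

  outside-nested : ∀ u v → inClique G u ≡ false → inClique G v ≡ false →
                   (∀ w → adj G u w ≡ true → adj G v w ≡ true) ⊎ (∀ w → adj G v w ≡ true → adj G u w ≡ true)
  outside-nested u v u∉K v∉K with ≤-total (degree G u) (degree G v)
  ... | inj₁ du≤dv = inj₁ λ w u~w → nested du≤dv u~w (nonNeighbour≢neighbour G (outside-nonadjacent u v u∉K v∉K) u~w)
  ... | inj₂ dv≤du = inj₂ λ w v~w → nested dv≤du v~w (nonNeighbour≢neighbour G (outside-nonadjacent v u v∉K u∉K) v~w)

  nestedByDegree⇒threshold : IsThreshold G
  nestedByDegree⇒threshold = inClique G , inClique-adjacent G , outside-nonadjacent , outside-nested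

lemma8 : (m : ℕ) → m ≥ 1 → (G : Graph) → edges G ≡ m →
         (∀ (G′ : Graph) → edges G′ ≡ m → expH G′ ≤ expH G) →
         IsThreshold G
lemma8 _ _ G refl maximal = nestedByDegree⇒threshold G (hMaximal⇒nestedByDegree G maximal)
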